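{- Let $A \subseteq \mathbb{Z}^d$ be an affine semigroup and $M \subseteq A$ an ideal. Then $M$ possesses an affine stratification in which each stratum is a translate $f_i + A_i$ ($f_i \in \mathbb{Z}^d$) of a face $A_i$ of $A$.
   Context: An affine semigroup is a finitely generated submonoid of $\mathbb{Z}^d$. An ideal of $A$ is a subset $M \subseteq A$ with $M + A \subseteq M$. A face of $A$ is a subset of the form $A \cap F$ where $F$ is a face of the real cone $\mathbb{R}_+ A$. A subset $W \subseteq \mathbb{Z}^d$ is a finitely generated module for an affine semigroup $A'$ if $W = F + A'$ for some finite $F \subseteq \mathbb{Z}^d$; an affine stratification of a set is a partition of it into finitely many pairwise disjoint sets each of which is a finitely generated module for some affine semigroup. -}

module Defs where

open import Data.Nat using (ℕ; zero; suc)
open import Data.Integer using (ℤ; +_; _+_; _*_; _≤_)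
open import Data.Fin using (Fin)
open import Data.Vec using (Vec; []; _∷_; replicate; zipWith; map)
open import Data.Unit using (⊤)
open import Data.Product using (Σ; ∃; _×_)
open import Relation.Binary.PropositionalEquality using (_≡_)

Point : ℕ → Set
Point d = Vec ℤ d

Subset : ℕ → Set₁
Subset d = Point d → Set

0ᵛ : ∀ {d} → Point d
0ᵛ {d} = replicate d (+ 0)

_⊕_ : ∀ {d} → Point d → Point d → Point d
x ⊕ y = zipWith _+_ x y

dot : ∀ {d} → Point d → Point d → ℤ
dot [] [] = + 0
dot (a ∷ as) (b ∷ bs) = a * b + dot as bs

combo : ∀ {d n} → Vec (Point d) n → Vec ℕ n → Point d
combo [] [] = 0ᵛ
combo (g ∷ gs) (c ∷ cs) = map (λ z → (+ c) * z) g ⊕ combo gs cs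

InSemigroup : ∀ {d n} → Vec (Point d) n → Subset d
InSemigroup gs x = Σ (Vec ℕ _) (λ c → x ≡ combo gs c)

IsIdeal : ∀ {d n} → Vec (Point d) n → Subset d → Set
IsIdeal gs M =
  ((x : Point _) → M x → InSemigroup gs x) ×
  ((x a : Point _) → M x → InSemigroup gs a → M (x ⊕ a))

-- A linear functional φ (given by an integer vector) is nonnegative on the
-- cone ℝ₊A iff it is nonnegative on every generator. Faces of the rational
-- polyhedral cone ℝ₊A are exactly the sets {v ∈ ℝ₊A : φ·v = 0} for such
-- integral φ (φ = 0 gives the whole cone).
Supporting : ∀ {d n} → Vec (Point d) n → Point d → Set
Supporting {d} {zero} [] φ = ⊤
Supporting {d} {suc n} (g ∷ gs) φ = (+ 0 ≤ dot φ g) × Supporting gs φ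

InFace : ∀ {d n} → Vec (Point d) n → Point d → Subset d
InFace gs φ x = InSemigroup gs x × dot φ x ≡ + 0

InTranslate : ∀ {d n} → Vec (Point d) n → Point d → Point d → Subset d
InTranslate gs f φ x = Σ (Point _) (λ y → InFace gs φ y × x ≡ f ⊕ y)

IsStratificationByFaces : ∀ {d n k} → Vec (Point d) n → Subset d →
  (Fin k → Point d) → (Fin k → Point d) → Set
IsStratificationByFaces {d} {n} {k} gs M f φ =
  ((i : Fin k) → Supporting gs (φ i)) ×
  ((x : Point d) → M x → ∃ λ (i : Fin k) → InTranslate gs (f i) (φ i) x) ×
  ((x : Point d) (i : Fin k) → InTranslate gs (f i) (φ i) x → M x) ×
  ((x : Point d) (i j : Fin k) → InTranslate gs (f i) (φ i) x →
     InTranslate gs (f j) (φ j) x → i ≡ j)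

module Submission where

-- Strata are added one at a time while some x ∈ M is not covered by the ideal ⟨S⟩ generated
-- by the translates chosen so far. Moving x inside x + A, one reaches a y whose colon ideal
-- (⟨S⟩ : y) = {a ∈ A : y + a ∈ ⟨S⟩} is prime. The complement of a prime ideal of A is a face
-- A ∩ φ⊥, the functional φ being supplied by Motzkin's transposition theorem, so the new stratum
-- y + (A ∩ φ⊥) is exactly the uncovered part of y + A. Both searches terminate because, by
-- Dickson's lemma, A admits no infinite strictly increasing chain of finitely generated ideals.

open import Defs
open import Level using (0ℓ)
open import Axiom.ExcludedMiddle using (ExcludedMiddle)
open import Axiom.DoubleNegationElimination using (em⇒dne)
open import Data.Bool using (Bool; true; false; _∨_; T)
open import Data.Bool.Properties using (∨-idem)
open import Data.Empty using (⊥; ⊥-elim)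
open import Data.Fin using (Fin; zero; suc)
open import Data.Integer as Z using (ℤ; +_; +0; +[1+_]; -[1+_])
import Data.Integer.Properties as ZP
open import Data.Integer.Tactic.RingSolver using (solve-∀)
open import Data.List as List using (List; []; _∷_; _++_; length; lookup; cartesianProductWith)
open import Data.List.Membership.Propositional using (_∈_; lose)
open import Data.List.Membership.Propositional.Properties
  using (∈-lookup; ∈-++⁺ʳ; ∈-cartesianProductWith⁺; ∈-cartesianProductWith⁻)
open import Data.List.Relation.Unary.All as All using (All; []; _∷_)
import Data.List.Relation.Unary.All.Properties as All
open import Data.List.Relation.Unary.Any as Any using (Any; here; there)
open import Data.Nat as N using (ℕ; zero; suc; s≤s)
import Data.Nat.Properties as NP
open import Data.Nat.Induction using (<-wellFounded)
open import Data.Product using (Σ; ∃; ∃₂; _×_; _,_; proj₁; proj₂)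
open import Data.Rational.Unnormalised as Q using (ℚᵘ; mkℚᵘ; 0ℚᵘ)
import Data.Rational.Unnormalised.Properties as QP
open import Data.List.Extrema QP.≤-totalOrder
  using (argmax; argmin; f[⊥]≤f[argmax]; f[xs]≤f[argmax]; f[argmin]≤f[⊤]; f[argmin]≤f[xs];
         argmax-all; argmin-all)
open import Data.Sum using (_⊎_; inj₁; inj₂; [_,_]′)
open import Data.Unit using (tt)
open import Data.Vec as Vec using (Vec; []; _∷_; replicate; zipWith)
open import Data.Vec.Properties using (map-cong; map-id; map-const)
open import Data.Vec.Relation.Unary.All as Allᵛ using ([]; _∷_) renaming (All to Allᵛ)
open import Data.Vec.Relation.Binary.Pointwise.Inductive
  using (Pointwise; []; _∷_; Pointwise-≡⇒≡; zipWith-comm; zipWith-assoc; zipWith-identityˡ; zipWith-identityʳ)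
open import Function using (_∘_; _⇔_; mk⇔; Equivalence)
open import Induction.WellFounded using (Acc; acc; WellFounded)
open import Relation.Binary.Definitions using (Transitive)
open import Relation.Nullary using (¬_; Dec; yes; no)
open import Relation.Binary.PropositionalEquality

infix 30 -ᵛ_
infixr 25 _*ᵛ_

_*ᵛ_ : ∀ {d} → ℤ → Point d → Point d
k *ᵛ x = Vec.map (k Z.*_) x

-ᵛ_ : ∀ {d} → Point d → Point d
-ᵛ_ = Vec.map (Z.-_)

⊕-comm : ∀ {d} (x y : Point d) → x ⊕ y ≡ y ⊕ x
⊕-comm x y = Pointwise-≡⇒≡ (zipWith-comm ZP.+-comm x y)

⊕-assoc : ∀ {d} (x y z : Point d) → (x ⊕ y) ⊕ z ≡ x ⊕ (y ⊕ z)
⊕-assoc x y z = Pointwise-≡⇒≡ (zipWith-assoc ZP.+-assoc x y z)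

⊕-identityˡ : ∀ {d} (x : Point d) → 0ᵛ ⊕ x ≡ x
⊕-identityˡ x = Pointwise-≡⇒≡ (zipWith-identityˡ ZP.+-identityˡ x)

⊕-identityʳ : ∀ {d} (x : Point d) → x ⊕ 0ᵛ ≡ x
⊕-identityʳ x = Pointwise-≡⇒≡ (zipWith-identityʳ ZP.+-identityʳ x)

⊕-inverseˡ : ∀ {d} (x : Point d) → -ᵛ x ⊕ x ≡ 0ᵛ
⊕-inverseˡ [] = refl
⊕-inverseˡ (a ∷ x) = cong₂ _∷_ (ZP.+-inverseˡ a) (⊕-inverseˡ x)

⊕-interchange : ∀ {d} (w x y z : Point d) → (w ⊕ x) ⊕ (y ⊕ z) ≡ (w ⊕ y) ⊕ (x ⊕ z)
⊕-interchange [] [] [] [] = refl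
⊕-interchange (a ∷ w) (b ∷ x) (c ∷ y) (e ∷ z) =
  cong₂ _∷_ (interchange a b c e) (⊕-interchange w x y z)
  where
  interchange : ∀ a b c e → (a Z.+ b) Z.+ (c Z.+ e) ≡ (a Z.+ c) Z.+ (b Z.+ e)
  interchange = solve-∀

*ᵛ-distribʳ : ∀ {d} (a b : ℤ) (x : Point d) → (a Z.+ b) *ᵛ x ≡ a *ᵛ x ⊕ b *ᵛ x
*ᵛ-distribʳ a b [] = refl
*ᵛ-distribʳ a b (c ∷ x) = cong₂ _∷_ (ZP.*-distribʳ-+ c a b) (*ᵛ-distribʳ a b x)

*ᵛ-identityˡ : ∀ {d} (x : Point d) → (+ 1) *ᵛ x ≡ x
*ᵛ-identityˡ x = trans (map-cong ZP.*-identityˡ x) (map-id x)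

*ᵛ-zeroˡ : ∀ {d} (x : Point d) → (+ 0) *ᵛ x ≡ 0ᵛ
*ᵛ-zeroˡ x = trans (map-cong ZP.*-zeroˡ x) (map-const x (+ 0))

*ᵛ-suc : ∀ {d} (k : ℕ) (x : Point d) → (+ suc k) *ᵛ x ≡ x ⊕ (+ k) *ᵛ x
*ᵛ-suc k x = trans (*ᵛ-distribʳ (+ 1) (+ k) x) (cong (_⊕ (+ k) *ᵛ x) (*ᵛ-identityˡ x))

dot-⊕ʳ : ∀ {d} (φ x y : Point d) → dot φ (x ⊕ y) ≡ dot φ x Z.+ dot φ y
dot-⊕ʳ [] [] [] = refl
dot-⊕ʳ (a ∷ φ) (b ∷ x) (c ∷ y) rewrite dot-⊕ʳ φ x y = distrib a b c (dot φ x) (dot φ y)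
  where
  distrib : ∀ a b c X Y → a Z.* (b Z.+ c) Z.+ (X Z.+ Y) ≡ (a Z.* b Z.+ X) Z.+ (a Z.* c Z.+ Y)
  distrib = solve-∀

dot-*ᵛʳ : ∀ {d} (k : ℤ) (φ x : Point d) → dot φ (k *ᵛ x) ≡ k Z.* dot φ x
dot-*ᵛʳ k [] [] = sym (ZP.*-zeroʳ k)
dot-*ᵛʳ k (a ∷ φ) (b ∷ x) rewrite dot-*ᵛʳ k φ x = distrib k a b (dot φ x)
  where
  distrib : ∀ k a b X → a Z.* (k Z.* b) Z.+ k Z.* X ≡ k Z.* (a Z.* b Z.+ X)
  distrib = solve-∀

dot-*ᵛˡ : ∀ {d} (k : ℤ) (φ x : Point d) → dot (k *ᵛ φ) x ≡ k Z.* dot φ x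
dot-*ᵛˡ k [] [] = sym (ZP.*-zeroʳ k)
dot-*ᵛˡ k (a ∷ φ) (b ∷ x) rewrite dot-*ᵛˡ k φ x = distrib k a b (dot φ x)
  where
  distrib : ∀ k a b X → (k Z.* a) Z.* b Z.+ k Z.* X ≡ k Z.* (a Z.* b Z.+ X)
  distrib = solve-∀

dot-0ᵛʳ : ∀ {d} (φ : Point d) → dot φ 0ᵛ ≡ +0
dot-0ᵛʳ [] = refl
dot-0ᵛʳ (a ∷ φ) rewrite dot-0ᵛʳ φ | ZP.*-zeroʳ a = refl

dot--ᵛʳ : ∀ {d} (φ x : Point d) → dot φ (-ᵛ x) ≡ Z.- dot φ x
dot--ᵛʳ [] [] = refl
dot--ᵛʳ (a ∷ φ) (b ∷ x) rewrite dot--ᵛʳ φ x = distrib a b (dot φ x)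
  where
  distrib : ∀ a b X → a Z.* (Z.- b) Z.+ Z.- X ≡ Z.- (a Z.* b Z.+ X)
  distrib = solve-∀

-- Dickson's lemma

stepwise⇒increasing : ∀ {A : Set} {_∼_ : A → A → Set} → Transitive _∼_ →
  (f : ℕ → A) → (∀ k → f k ∼ f (suc k)) → ∀ {i j} → i N.< j → f i ∼ f j
stepwise⇒increasing {_∼_ = _∼_} trans∼ f step {i} {suc j} (s≤s i≤j) with NP.m≤n⇒m<n∨m≡n i≤j
... | inj₁ i<j = trans∼ (stepwise⇒increasing {_∼_ = _∼_} trans∼ f step i<j) (step j)
... | inj₂ refl = step i

StrictlyIncreasing : (ℕ → ℕ) → Set
StrictlyIncreasing σ = ∀ k → σ k N.< σ (suc k)

Pointwise-head-tail : ∀ {n} (u v : Vec ℕ (suc n)) → Vec.head u N.≤ Vec.head v →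
  Pointwise N._≤_ (Vec.tail u) (Vec.tail v) → Pointwise N._≤_ u v
Pointwise-head-tail (x ∷ u) (y ∷ v) x≤y u≤v = x≤y ∷ u≤v

module _ (em : ExcludedMiddle 0ℓ) where

  minimumFrom : (f : ℕ → ℕ) (b : ℕ) → ∃ λ i → b N.≤ i × (∀ j → b N.≤ j → f i N.≤ f j)
  minimumFrom f b = descend b NP.≤-refl (<-wellFounded (f b))
    where
    descend : ∀ i → b N.≤ i → Acc N._<_ (f i) → ∃ λ i → b N.≤ i × (∀ j → b N.≤ j → f i N.≤ f j)
    descend i b≤i (acc rs) with em {∃ λ j → b N.≤ j × f j N.< f i}
    ... | yes (j , b≤j , fj<fi) = descend j b≤j (rs fj<fi)
    ... | no ∄smaller = i , b≤i , λ j b≤j → NP.≮⇒≥ (λ fj<fi → ∄smaller (j , b≤j , fj<fi))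

  nondecreasing-subsequence : (f : ℕ → ℕ) →
    ∃ λ σ → StrictlyIncreasing σ × (∀ k → f (σ k) N.≤ f (σ (suc k)))
  nondecreasing-subsequence f = σ , σ-increasing , λ k →
    proj₂ (proj₂ (minimum k)) (σ (suc k)) (NP.≤-trans (start≤σ k) (NP.<⇒≤ (σ-increasing k)))
    where
    start : ℕ → ℕ
    minimum : ∀ k → ∃ λ i → start k N.≤ i × (∀ j → start k N.≤ j → f i N.≤ f j)
    minimum k = minimumFrom f (start k)
    start zero = 0
    start (suc k) = suc (proj₁ (minimum k))
    σ : ℕ → ℕ
    σ k = proj₁ (minimum k)
    start≤σ : ∀ k → start k N.≤ σ k
    start≤σ k = proj₁ (proj₂ (minimum k))
    σ-increasing : StrictlyIncreasing σ
    σ-increasing k = start≤σ (suc k)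

  dickson-subsequence : ∀ n (h : ℕ → Vec ℕ n) →
    ∃ λ σ → StrictlyIncreasing σ × (∀ k → Pointwise N._≤_ (h (σ k)) (h (σ (suc k))))
  dickson-subsequence zero h = (λ k → k) , (λ k → NP.≤-refl) , λ k → nil≤nil (h k) (h (suc k))
    where
    nil≤nil : (u v : Vec ℕ 0) → Pointwise N._≤_ u v
    nil≤nil [] [] = []
  dickson-subsequence (suc n) h with nondecreasing-subsequence (Vec.head ∘ h)
  ... | σ₁ , σ₁-increasing , heads≤ with dickson-subsequence n (Vec.tail ∘ h ∘ σ₁)
  ... | σ₂ , σ₂-increasing , tails≤ =
    σ₁ ∘ σ₂ ,
    (λ k → stepwise⇒increasing {_∼_ = N._<_} NP.<-trans σ₁ σ₁-increasing (σ₂-increasing k)) ,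
    λ k → Pointwise-head-tail (h (σ₁ (σ₂ k))) (h (σ₁ (σ₂ (suc k))))
            (stepwise⇒increasing {_∼_ = N._≤_} NP.≤-trans (Vec.head ∘ h ∘ σ₁) heads≤ (σ₂-increasing k))
            (tails≤ k)

  dickson : ∀ n (h : ℕ → Vec ℕ n) → ∃₂ λ i j → i N.< j × Pointwise N._≤_ (h i) (h j)
  dickson n h with dickson-subsequence n h
  ... | σ , σ-increasing , h∘σ≤ = σ 0 , σ 1 , σ-increasing 0 , h∘σ≤ 0

infix 4 _<ℤ[_]_ _<[_]_

_<ℤ[_]_ : ℤ → Bool → ℤ → Set
x <ℤ[ true ] y = x Z.< y
x <ℤ[ false ] y = x Z.≤ y

+-monoˡ-<ℤ[] : ∀ s z {x y} → x <ℤ[ s ] y → x Z.+ z <ℤ[ s ] y Z.+ z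
+-monoˡ-<ℤ[] true z = ZP.+-monoˡ-< z
+-monoˡ-<ℤ[] false z = ZP.+-monoˡ-≤ z

0<ℤ[]-difference : ∀ s {x y} → x <ℤ[ s ] y → +0 <ℤ[ s ] y Z.- x
0<ℤ[]-difference s {x} {y} x<y =
  subst (λ w → w <ℤ[ s ] y Z.- x) (ZP.+-inverseʳ x) (+-monoˡ-<ℤ[] s (Z.- x) x<y)

0<ℤ[]-sum : ∀ s x y → +0 <ℤ[ s ] x Z.+ y → Z.- x <ℤ[ s ] y
0<ℤ[]-sum s x y 0<x+y =
  subst₂ (λ a b → a <ℤ[ s ] b) (ZP.+-identityˡ (Z.- x)) (cancel x y) (+-monoˡ-<ℤ[] s (Z.- x) 0<x+y)
  where
  cancel : ∀ x y → (x Z.+ y) Z.- x ≡ y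
  cancel = solve-∀

0<ℤ[]-*-pos : ∀ s k y → +0 <ℤ[ s ] y → +0 <ℤ[ s ] +[1+ k ] Z.* y
0<ℤ[]-*-pos true k y 0<y = subst (Z._< +[1+ k ] Z.* y) (ZP.*-zeroʳ +[1+ k ]) (ZP.*-monoˡ-<-pos +[1+ k ] 0<y)
0<ℤ[]-*-pos false k y 0≤y = subst (Z._≤ +[1+ k ] Z.* y) (ZP.*-zeroʳ +[1+ k ]) (ZP.*-monoˡ-≤-nonNeg +[1+ k ] 0≤y)

_<[_]_ : ℚᵘ → Bool → ℚᵘ → Set
p <[ true ] q = p Q.< q
p <[ false ] q = p Q.≤ q

<⇒<[] : ∀ s {p q} → p Q.< q → p <[ s ] q
<⇒<[] true p<q = p<q
<⇒<[] false p<q = QP.<⇒≤ p<q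

<[]-∨ʳ : ∀ b c {p q} → p <[ b ∨ c ] q → p <[ c ] q
<[]-∨ʳ true c p<q = <⇒<[] c p<q
<[]-∨ʳ false c p<q = p<q

ℤ⇒ℚ-<[] : ∀ s {a k c m} → a Z.* +[1+ m ] <ℤ[ s ] c Z.* +[1+ k ] → mkℚᵘ a k <[ s ] mkℚᵘ c m
ℤ⇒ℚ-<[] true = Q.*<*
ℤ⇒ℚ-<[] false = Q.*≤*

ℚ⇒ℤ-<[] : ∀ s {a k c m} → mkℚᵘ a k <[ s ] mkℚᵘ c m → a Z.* +[1+ m ] <ℤ[ s ] c Z.* +[1+ k ]
ℚ⇒ℤ-<[] true (Q.*<* lt) = lt
ℚ⇒ℤ-<[] false (Q.*≤* le) = le

-- A rational between finitely many lower and upper bounds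

Bound : Set
Bound = ℚᵘ × Bool

_≺_ : Bound → ℚᵘ → Set
(l , b) ≺ t = l <[ b ] t

_≺′_ : ℚᵘ → Bound → Set
t ≺′ (u , c) = t <[ c ] u

value : Bound → ℚᵘ
value = proj₁

Compatible : Bound → Bound → Set
Compatible (l , b) (u , c) = l <[ b ∨ c ] u

bumpUp bumpDown : ℚᵘ → ℚᵘ
bumpUp (mkℚᵘ a e) = mkℚᵘ (Z.suc a) e
bumpDown (mkℚᵘ a e) = mkℚᵘ (Z.pred a) e

<-bumpUp : ∀ q → q Q.< bumpUp q
<-bumpUp (mkℚᵘ a e) = Q.*<* (ZP.*-monoʳ-<-pos +[1+ e ] (ZP.suc[i]≤j⇒i<j {a} ZP.≤-refl))

bumpDown-< : ∀ q → bumpDown q Q.< q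
bumpDown-< (mkℚᵘ a e) =
  subst (λ c → bumpDown (mkℚᵘ a e) Q.< mkℚᵘ c e) (ZP.suc-pred a) (<-bumpUp (bumpDown (mkℚᵘ a e)))

max≥ : ∀ (x : Bound) xs → All (λ y → value y Q.≤ value (argmax value x xs)) (x ∷ xs)
max≥ x xs = f[⊥]≤f[argmax] {f = value} x xs ∷ f[xs]≤f[argmax] x xs

min≤ : ∀ (x : Bound) xs → All (λ y → value (argmin value x xs) Q.≤ value y) (x ∷ xs)
min≤ x xs = f[argmin]≤f[⊤] {f = value} x xs ∷ f[argmin]≤f[xs] x xs

above-all : ∀ {m t} → m Q.< t → ∀ {ls} → All (λ l → value l Q.≤ m) ls → All (_≺ t) ls
above-all m<t = All.map λ { {l , b} l≤m → <⇒<[] b (QP.≤-<-trans l≤m m<t) }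

below-all : ∀ {m t} → t Q.< m → ∀ {us} → All (λ u → m Q.≤ value u) us → All (t ≺′_) us
below-all t<m = All.map λ { {u , c} m≤u → <⇒<[] c (QP.<-≤-trans t<m m≤u) }

between-two-sided : ∀ {ls us} (lmax umin : Bound) →
  All (λ l → value l Q.≤ value lmax) ls → All (λ u → value umin Q.≤ value u) us →
  All (Compatible lmax) us → All (λ l → Compatible l umin) ls →
  ∃ λ t → All (_≺ t) ls × All (t ≺′_) us
between-two-sided (lmax , b*) (umin , c*) ls≤lmax umin≤us lmax-compatible compatible-umin
  with lmax Q.<? umin
... | yes lmax<umin with QP.<-dense lmax<umin
...   | t , lmax<t , t<umin = t , above-all lmax<t ls≤lmax , below-all t<umin umin≤us
between-two-sided (lmax , b*) (umin , c*) ls≤lmax umin≤us lmax-compatible compatible-umin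
  | no lmax≮umin =
  lmax , lower ls≤lmax compatible-umin , All.map (λ { {u , c} → <[]-∨ʳ b* c }) lmax-compatible
  where
  -- The bounds meet, so a strict lower bound l lies below umin ≤ lmax.
  lower : ∀ {ls} → All (λ l → value l Q.≤ lmax) ls → All (λ l → Compatible l (umin , c*)) ls →
    All (_≺ lmax) ls
  lower {[]} [] [] = []
  lower {(l , true) ∷ ls} (_ ∷ ls≤) (l<umin ∷ cs) = QP.<-≤-trans l<umin (QP.≮⇒≥ lmax≮umin) ∷ lower ls≤ cs
  lower {(l , false) ∷ ls} (l≤lmax ∷ ls≤) (_ ∷ cs) = l≤lmax ∷ lower ls≤ cs

between : (ls us : List Bound) → All (λ l → All (Compatible l) us) ls →
  ∃ λ t → All (_≺ t) ls × All (t ≺′_) us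
between [] [] _ = 0ℚᵘ , [] , []
between [] (u ∷ us) _ = bumpDown umin , [] , below-all (bumpDown-< umin) (min≤ u us)
  where
  umin : ℚᵘ
  umin = value (argmin value u us)
between (l ∷ ls) [] _ = bumpUp lmax , above-all (<-bumpUp lmax) (max≥ l ls) , []
  where
  lmax : ℚᵘ
  lmax = value (argmax value l ls)
between (l ∷ ls) (u ∷ us) compatible@(row ∷ rows) =
  between-two-sided (argmax value l ls) (argmin value u us) (max≥ l ls) (min≤ u us)
    (argmax-all value row rows) (All.map (λ row → argmin-all value (All.head row) (All.tail row)) compatible)

-- Motzkin's transposition theorem, by Fourier–Motzkin elimination

Constraint : ℕ → Set
Constraint d = Point d × Bool

Satisfies : ∀ {d} → Point d → Constraint d → Set
Satisfies φ (v , s) = +0 <ℤ[ s ] dot φ v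

infix 4 _⊢_

data _⊢_ {d} (R : List (Constraint d)) : Constraint d → Set where
  assumption : ∀ {c} → c ∈ R → R ⊢ c
  add : ∀ {u w b c} → R ⊢ (u , b) → R ⊢ (w , c) → R ⊢ (u ⊕ w , b ∨ c)

⊢-weaken : ∀ {d} {R : List (Constraint d)} {c c′} → R ⊢ c → (c′ ∷ R) ⊢ c
⊢-weaken (assumption c∈R) = assumption (there c∈R)
⊢-weaken (add D E) = add (⊢-weaken D) (⊢-weaken E)

⊢-scale : ∀ {d} {R : List (Constraint d)} {u b} → R ⊢ (u , b) → ∀ k → R ⊢ (+[1+ k ] *ᵛ u , b)
⊢-scale {R = R} {u} {b} D zero = subst (λ v → R ⊢ (v , b)) (sym (*ᵛ-identityˡ u)) D
⊢-scale {R = R} {u} {b} D (suc k) =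
  subst₂ (λ v c → R ⊢ (v , c)) (sym (*ᵛ-suc (suc k) u)) (∨-idem b) (add D (⊢-scale D k))

withHead : ∀ {d} → ℤ → Constraint d → Constraint (suc d)
withHead a (v , b) = a ∷ v , b

zeros : ∀ {d} → List (Constraint (suc d)) → List (Constraint d)
zeros [] = []
zeros ((+0 ∷ v , b) ∷ R) = (v , b) ∷ zeros R
zeros ((+[1+ _ ] ∷ _ , _) ∷ R) = zeros R
zeros ((-[1+ _ ] ∷ _ , _) ∷ R) = zeros R

-- (k , c) ∈ positives R  encodes  withHead +[1+ k ] c ∈ R, and likewise for negatives.
positives negatives : ∀ {d} → List (Constraint (suc d)) → List (ℕ × Constraint d)
positives [] = []
positives ((+0 ∷ _ , _) ∷ R) = positives R
positives ((+[1+ k ] ∷ v , b) ∷ R) = (k , v , b) ∷ positives R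
positives ((-[1+ _ ] ∷ _ , _) ∷ R) = positives R
negatives [] = []
negatives ((+0 ∷ _ , _) ∷ R) = negatives R
negatives ((+[1+ _ ] ∷ _ , _) ∷ R) = negatives R
negatives ((-[1+ k ] ∷ v , b) ∷ R) = (k , v , b) ∷ negatives R

combine : ∀ {d} → ℕ × Constraint d → ℕ × Constraint d → Constraint d
combine (k , p , b) (m , q , c) = +[1+ m ] *ᵛ p ⊕ +[1+ k ] *ᵛ q , b ∨ c

eliminate : ∀ {d} → List (Constraint (suc d)) → List (Constraint d)
eliminate R = zeros R ++ cartesianProductWith combine (positives R) (negatives R)

zeros-derivable : ∀ {d} (R : List (Constraint (suc d))) → All (λ c → R ⊢ withHead +0 c) (zeros R)
zeros-derivable [] = []
zeros-derivable ((+0 ∷ v , b) ∷ R) = assumption (here refl) ∷ All.map ⊢-weaken (zeros-derivable R)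
zeros-derivable ((+[1+ _ ] ∷ _ , _) ∷ R) = All.map ⊢-weaken (zeros-derivable R)
zeros-derivable ((-[1+ _ ] ∷ _ , _) ∷ R) = All.map ⊢-weaken (zeros-derivable R)

positives-derivable : ∀ {d} (R : List (Constraint (suc d))) →
  All (λ p → R ⊢ withHead +[1+ proj₁ p ] (proj₂ p)) (positives R)
positives-derivable [] = []
positives-derivable ((+0 ∷ _ , _) ∷ R) = All.map ⊢-weaken (positives-derivable R)
positives-derivable ((+[1+ _ ] ∷ _ , _) ∷ R) =
  assumption (here refl) ∷ All.map ⊢-weaken (positives-derivable R)
positives-derivable ((-[1+ _ ] ∷ _ , _) ∷ R) = All.map ⊢-weaken (positives-derivable R)

negatives-derivable : ∀ {d} (R : List (Constraint (suc d))) →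
  All (λ p → R ⊢ withHead -[1+ proj₁ p ] (proj₂ p)) (negatives R)
negatives-derivable [] = []
negatives-derivable ((+0 ∷ _ , _) ∷ R) = All.map ⊢-weaken (negatives-derivable R)
negatives-derivable ((+[1+ _ ] ∷ _ , _) ∷ R) = All.map ⊢-weaken (negatives-derivable R)
negatives-derivable ((-[1+ _ ] ∷ _ , _) ∷ R) =
  assumption (here refl) ∷ All.map ⊢-weaken (negatives-derivable R)

combine-derivable : ∀ {d} {R : List (Constraint (suc d))} {k m p q} →
  R ⊢ withHead +[1+ k ] p → R ⊢ withHead -[1+ m ] q → R ⊢ withHead +0 (combine (k , p) (m , q))
combine-derivable {R = R} {k} {m} {p , b} {q , c} D E =
  subst (λ a → R ⊢ (a ∷ proj₁ (combine (k , p , b) (m , q , c)) , b ∨ c)) (cancel +[1+ m ] +[1+ k ])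
    (add (⊢-scale D m) (⊢-scale E k))
  where
  cancel : ∀ a b → a Z.* b Z.+ b Z.* (Z.- a) ≡ +0
  cancel = solve-∀

eliminate-derivable : ∀ {d} (R : List (Constraint (suc d))) → All (λ c → R ⊢ withHead +0 c) (eliminate R)
eliminate-derivable R = All.++⁺ (zeros-derivable R) (All.tabulate pair-derivable)
  where
  pair-derivable : ∀ {c} → c ∈ cartesianProductWith combine (positives R) (negatives R) → R ⊢ withHead +0 c
  pair-derivable c∈ with ∈-cartesianProductWith⁻ combine (positives R) (negatives R) c∈
  ... | _ , _ , p∈ , q∈ , refl =
    combine-derivable (All.lookup (positives-derivable R) p∈) (All.lookup (negatives-derivable R) q∈)

lift-derivation : ∀ {d} (R : List (Constraint (suc d))) {c} → eliminate R ⊢ c → R ⊢ withHead +0 c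
lift-derivation R (assumption c∈) = All.lookup (eliminate-derivable R) c∈
lift-derivation R (add D E) = add (lift-derivation R D) (lift-derivation R E)

-- The new coordinate t = T / (e + 1) is cleared of its denominator by scaling φ′.
extendFunctional : ∀ {d} → ℚᵘ → Point d → Point (suc d)
extendFunctional (mkℚᵘ T e) φ′ = T ∷ +[1+ e ] *ᵛ φ′

module _ {d} (φ′ : Point d) where

  lowerBound upperBound : ℕ × Constraint d → Bound
  lowerBound (k , v , b) = mkℚᵘ (Z.- dot φ′ v) k , b
  upperBound (m , v , c) = mkℚᵘ (dot φ′ v) m , c

  combine-compatible : ∀ p q → Satisfies φ′ (combine p q) → Compatible (lowerBound p) (upperBound q)
  combine-compatible (k , v , b) (m , w , c) sat =
    ℤ⇒ℚ-<[] (b ∨ c)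
      (subst₂ (λ x y → x <ℤ[ b ∨ c ] y) (swap-neg +[1+ m ] (dot φ′ v)) (ZP.*-comm +[1+ k ] (dot φ′ w))
        (0<ℤ[]-sum (b ∨ c) _ _ (subst (λ z → +0 <ℤ[ b ∨ c ] z) expand sat)))
    where
    swap-neg : ∀ M A → Z.- (M Z.* A) ≡ Z.- A Z.* M
    swap-neg = solve-∀
    expand : dot φ′ (+[1+ m ] *ᵛ v ⊕ +[1+ k ] *ᵛ w) ≡ +[1+ m ] Z.* dot φ′ v Z.+ +[1+ k ] Z.* dot φ′ w
    expand = trans (dot-⊕ʳ φ′ _ _) (cong₂ Z._+_ (dot-*ᵛʳ +[1+ m ] φ′ v) (dot-*ᵛʳ +[1+ k ] φ′ w))

  compatible : (R : List (Constraint (suc d))) → All (Satisfies φ′) (eliminate R) →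
    All (λ l → All (Compatible l) (List.map upperBound (negatives R))) (List.map lowerBound (positives R))
  compatible R sat = All.map⁺ (All.tabulate λ {p} p∈ → All.map⁺ (All.tabulate λ {q} q∈ →
    combine-compatible p q (All.lookup sat (∈-++⁺ʳ (zeros R) (∈-cartesianProductWith⁺ combine p∈ q∈)))))

  satisfies-zero : ∀ t {v b} → Satisfies φ′ (v , b) → Satisfies (extendFunctional t φ′) (+0 ∷ v , b)
  satisfies-zero (mkℚᵘ T e) {v} {b} sat = subst (λ z → +0 <ℤ[ b ] z) eq (0<ℤ[]-*-pos b e (dot φ′ v) sat)
    where
    eq : +[1+ e ] Z.* dot φ′ v ≡ T Z.* +0 Z.+ dot (+[1+ e ] *ᵛ φ′) v
    eq = begin
      +[1+ e ] Z.* dot φ′ v                 ≡⟨ sym (dot-*ᵛˡ +[1+ e ] φ′ v) ⟩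
      dot (+[1+ e ] *ᵛ φ′) v               ≡⟨ sym (ZP.+-identityˡ _) ⟩
      +0 Z.+ dot (+[1+ e ] *ᵛ φ′) v         ≡⟨ cong (Z._+ _) (sym (ZP.*-zeroʳ T)) ⟩
      T Z.* +0 Z.+ dot (+[1+ e ] *ᵛ φ′) v   ∎
      where open ≡-Reasoning

  satisfies-positive : ∀ t {k v b} → lowerBound (k , v , b) ≺ t →
    Satisfies (extendFunctional t φ′) (+[1+ k ] ∷ v , b)
  satisfies-positive (mkℚᵘ T e) {k} {v} {b} below =
    subst (λ z → +0 <ℤ[ b ] z) eq (0<ℤ[]-difference b (ℚ⇒ℤ-<[] b below))
    where
    rearrange : ∀ T K D A → T Z.* K Z.- Z.- A Z.* D ≡ T Z.* K Z.+ D Z.* A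
    rearrange = solve-∀
    eq : T Z.* +[1+ k ] Z.- Z.- dot φ′ v Z.* +[1+ e ] ≡ T Z.* +[1+ k ] Z.+ dot (+[1+ e ] *ᵛ φ′) v
    eq = trans (rearrange T +[1+ k ] +[1+ e ] (dot φ′ v))
               (cong (Z._+_ (T Z.* +[1+ k ])) (sym (dot-*ᵛˡ +[1+ e ] φ′ v)))

  satisfies-negative : ∀ t {m v c} → t ≺′ upperBound (m , v , c) →
    Satisfies (extendFunctional t φ′) (-[1+ m ] ∷ v , c)
  satisfies-negative (mkℚᵘ T e) {m} {v} {c} above =
    subst (λ z → +0 <ℤ[ c ] z) eq (0<ℤ[]-difference c (ℚ⇒ℤ-<[] c above))
    where
    rearrange : ∀ T M D B → B Z.* D Z.- T Z.* M ≡ T Z.* Z.- M Z.+ D Z.* B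
    rearrange = solve-∀
    eq : dot φ′ v Z.* +[1+ e ] Z.- T Z.* +[1+ m ] ≡ T Z.* -[1+ m ] Z.+ dot (+[1+ e ] *ᵛ φ′) v
    eq = trans (rearrange T +[1+ m ] +[1+ e ] (dot φ′ v))
               (cong (Z._+_ (T Z.* -[1+ m ])) (sym (dot-*ᵛˡ +[1+ e ] φ′ v)))

  extend : ∀ t (R : List (Constraint (suc d))) → All (Satisfies φ′) (zeros R) →
    All ((_≺ t) ∘ lowerBound) (positives R) → All ((t ≺′_) ∘ upperBound) (negatives R) →
    All (Satisfies (extendFunctional t φ′)) R
  extend t [] [] [] [] = []
  extend t ((+0 ∷ _ , _) ∷ R) (sat ∷ zs) ls us = satisfies-zero t sat ∷ extend t R zs ls us
  extend t ((+[1+ _ ] ∷ _ , _) ∷ R) zs (l ∷ ls) us = satisfies-positive t l ∷ extend t R zs ls us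
  extend t ((-[1+ _ ] ∷ _ , _) ∷ R) zs ls (u ∷ us) = satisfies-negative t u ∷ extend t R zs ls us

motzkin : ∀ d (R : List (Constraint d)) → ¬ R ⊢ (0ᵛ , true) → ∃ λ φ → All (Satisfies φ) R
motzkin zero R ⊬0>0 = [] , All.tabulate satisfied
  where
  satisfied : ∀ {c} → c ∈ R → Satisfies [] c
  satisfied {[] , true} c∈R = ⊥-elim (⊬0>0 (assumption c∈R))
  satisfied {[] , false} _ = ZP.≤-refl
motzkin (suc d) R ⊬0>0 with motzkin d (eliminate R) (λ D → ⊬0>0 (lift-derivation R D))
... | φ′ , sat with between (List.map (lowerBound φ′) (positives R)) (List.map (upperBound φ′) (negatives R))
                       (compatible φ′ R sat)
... | t , below , above =
  extendFunctional t φ′ , extend φ′ t R (All.++⁻ˡ (zeros R) sat) (All.map⁻ below) (All.map⁻ above)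

-- Affine semigroups

combo-+ : ∀ {d n} (gs : Vec (Point d) n) (c e : Vec ℕ n) →
  combo gs (zipWith N._+_ c e) ≡ combo gs c ⊕ combo gs e
combo-+ [] [] [] = sym (⊕-identityˡ 0ᵛ)
combo-+ (g ∷ gs) (c ∷ cs) (e ∷ es) =
  trans (cong₂ _⊕_ (*ᵛ-distribʳ (+ c) (+ e) g) (combo-+ gs cs es))
        (⊕-interchange ((+ c) *ᵛ g) ((+ e) *ᵛ g) (combo gs cs) (combo gs es))

combo-0 : ∀ {d n} (gs : Vec (Point d) n) → combo gs (replicate n 0) ≡ 0ᵛ
combo-0 [] = refl
combo-0 (g ∷ gs) = trans (cong₂ _⊕_ (*ᵛ-zeroˡ g) (combo-0 gs)) (⊕-identityˡ 0ᵛ)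

generators∈semigroup : ∀ {d n} (gs : Vec (Point d) n) → Allᵛ (InSemigroup gs) gs
generators∈semigroup [] = []
generators∈semigroup (g ∷ gs) = g∈ ∷ Allᵛ.map shift (generators∈semigroup gs)
  where
  g∈ : InSemigroup (g ∷ gs) g
  g∈ = 1 ∷ replicate _ 0 , sym (trans (cong₂ _⊕_ (*ᵛ-identityˡ g) (combo-0 gs)) (⊕-identityʳ g))
  shift : ∀ {x} → InSemigroup gs x → InSemigroup (g ∷ gs) x
  shift (c , refl) = 0 ∷ c , sym (trans (cong (_⊕ combo gs c) (*ᵛ-zeroˡ g)) (⊕-identityˡ _))

InSemigroup-induction : ∀ {d n} {gs : Vec (Point d) n} (Q : Subset d) → Q 0ᵛ →
  (∀ {a b} → Q a → Q b → Q (a ⊕ b)) → Allᵛ Q gs → ∀ {x} → InSemigroup gs x → Q x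
InSemigroup-induction {d} Q Q0 Q⊕ Qgs (c , refl) = Q-combo Qgs c
  where
  Q-scale : ∀ {h} k → Q h → Q ((+ k) *ᵛ h)
  Q-scale {h} zero _ = subst Q (sym (*ᵛ-zeroˡ h)) Q0
  Q-scale {h} (suc k) Qh = subst Q (sym (*ᵛ-suc k h)) (Q⊕ Qh (Q-scale k Qh))
  Q-combo : ∀ {m} {hs : Vec (Point d) m} → Allᵛ Q hs → ∀ c → Q (combo hs c)
  Q-combo [] [] = Q0
  Q-combo (Qh ∷ Qhs) (k ∷ ks) = Q⊕ (Q-scale k Qh) (Q-combo Qhs ks)

Pointwise-≤⇒≡+∸ : ∀ {n} {c e : Vec ℕ n} → Pointwise N._≤_ c e → e ≡ zipWith N._+_ c (zipWith N._∸_ e c)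
Pointwise-≤⇒≡+∸ [] = refl
Pointwise-≤⇒≡+∸ (x≤y ∷ c≤e) = cong₂ _∷_ (sym (NP.m+[n∸m]≡n x≤y)) (Pointwise-≤⇒≡+∸ c≤e)

Supporting-nonneg : ∀ {d n} {gs : Vec (Point d) n} {φ} → Allᵛ (λ g → +0 Z.≤ dot φ g) gs → Supporting gs φ
Supporting-nonneg [] = tt
Supporting-nonneg (0≤φg ∷ 0≤φgs) = 0≤φg , Supporting-nonneg 0≤φgs

module AffineSemigroup {d n : ℕ} (gs : Vec (Point d) n) where

  InA : Subset d
  InA = InSemigroup gs

  0ᵛ∈A : InA 0ᵛ
  0ᵛ∈A = replicate n 0 , sym (combo-0 gs)

  ⊕∈A : ∀ {x y} → InA x → InA y → InA (x ⊕ y)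
  ⊕∈A (c , refl) (e , refl) = zipWith N._+_ c e , sym (combo-+ gs c e)

  infix 4 _≼_

  _≼_ : Point d → Point d → Set
  x ≼ z = Σ (Point d) λ a → InA a × z ≡ x ⊕ a

  ≼-⊕ʳ : ∀ {x z b} → x ≼ z → InA b → x ≼ z ⊕ b
  ≼-⊕ʳ {x} {b = b} (a , a∈A , refl) b∈A = a ⊕ b , ⊕∈A a∈A b∈A , ⊕-assoc x a b

  combo-≼ : ∀ {c e} → Pointwise N._≤_ c e → combo gs c ≼ combo gs e
  combo-≼ {c} {e} c≤e = combo gs (zipWith N._∸_ e c) , (_ , refl) ,
    trans (cong (combo gs) (Pointwise-≤⇒≡+∸ c≤e)) (combo-+ gs c _)

  InIdeal : List (Point d) → Subset d
  InIdeal xs z = Any (_≼ z) xs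

  InIdeal-⊕ʳ : ∀ {xs z b} → InIdeal xs z → InA b → InIdeal xs (z ⊕ b)
  InIdeal-⊕ʳ z∈ b∈A = Any.map (λ x≼z → ≼-⊕ʳ x≼z b∈A) z∈

  data _Enlarges_ : List (Point d) → List (Point d) → Set where
    enlarge : ∀ {x xs} → InA x → ¬ InIdeal xs x → (x ∷ xs) Enlarges xs

  record IsPrimeIdeal (P : Subset d) : Set where
    field
      proper : ¬ P 0ᵛ
      absorbs : ∀ {a b} → P a → InA b → P (a ⊕ b)
      prime : ∀ {a b} → InA a → InA b → P (a ⊕ b) → P a ⊎ P b

    absorbsˡ : ∀ {a b} → InA a → P b → P (a ⊕ b)
    absorbsˡ {a} {b} a∈A b∈P = subst P (⊕-comm b a) (absorbs b∈P a∈A)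

  module _ (em : ExcludedMiddle 0ℓ) where

    private
      dne : ∀ {P : Set} → ¬ ¬ P → P
      dne = em⇒dne em

    -- Classically, an inaccessible list yields an infinite sequence x₀, x₁, … in A in which
    -- no xᵢ divides a later xⱼ; Dickson's lemma on their coefficient vectors forbids this.
    module InfiniteEnlargement (xs₀ : List (Point d)) (¬acc₀ : ¬ Acc _Enlarges_ xs₀) where

      enlarge-inaccessible : ∀ xs → ¬ Acc _Enlarges_ xs →
        Σ (Point d) λ x → InA x × ¬ InIdeal xs x × ¬ Acc _Enlarges_ (x ∷ xs)
      enlarge-inaccessible xs ¬acc = dne λ ∄x → ¬acc (acc λ { (enlarge x∈A x∉) →
        dne λ ¬acc′ → ∄x (_ , x∈A , x∉ , ¬acc′) })

      stage : ℕ → Σ (List (Point d)) (¬_ ∘ Acc _Enlarges_)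
      next : (k : ℕ) → Σ (Point d) λ x →
        InA x × ¬ InIdeal (proj₁ (stage k)) x × ¬ Acc _Enlarges_ (x ∷ proj₁ (stage k))
      stage zero = xs₀ , ¬acc₀
      stage (suc k) = proj₁ (next k) ∷ proj₁ (stage k) , proj₂ (proj₂ (proj₂ (next k)))
      next k = enlarge-inaccessible (proj₁ (stage k)) (proj₂ (stage k))

      point : ℕ → Point d
      point k = proj₁ (next k)

      point∈A : ∀ k → InA (point k)
      point∈A k = proj₁ (proj₂ (next k))

      point∉ : ∀ k → ¬ InIdeal (proj₁ (stage k)) (point k)
      point∉ k = proj₁ (proj₂ (proj₂ (next k)))

      earlier∈stage : ∀ {i j} → i N.< j → point i ∈ proj₁ (stage j)
      earlier∈stage {i} {suc j} (s≤s i≤j) with NP.m≤n⇒m<n∨m≡n i≤j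
      ... | inj₁ i<j = there (earlier∈stage i<j)
      ... | inj₂ refl = here refl

      impossible : ⊥
      impossible with dickson em n (proj₁ ∘ point∈A)
      ... | i , j , i<j , cᵢ≤cⱼ = point∉ j (lose (earlier∈stage i<j) pointᵢ≼pointⱼ)
        where
        pointᵢ≼pointⱼ : point i ≼ point j
        pointᵢ≼pointⱼ = subst₂ _≼_ (sym (proj₂ (point∈A i))) (sym (proj₂ (point∈A j))) (combo-≼ cᵢ≤cⱼ)

    enlarges-wellFounded : WellFounded _Enlarges_
    enlarges-wellFounded xs = dne λ ¬acc → InfiniteEnlargement.impossible xs ¬acc

    module PrimeFace {P : Subset d} (isPrime : IsPrimeIdeal P) where
      open IsPrimeIdeal isPrime

      -- The sought φ is positive on the generators in P and vanishes on the others.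
      constraintsFor : (h : Point d) → Dec (P h) → List (Constraint d)
      constraintsFor h (yes _) = (h , true) ∷ []
      constraintsFor h (no _) = (h , false) ∷ (-ᵛ h , false) ∷ []

      constraints : ∀ {m} → Vec (Point d) m → List (Constraint d)
      constraints [] = []
      constraints (h ∷ hs) = constraintsFor h em ++ constraints hs

      -- Derivable constraints have the shape x − y with x, y ∈ A, y ∉ P, and x ∈ P when strict;
      -- for 0 > 0 this would force y = x ∈ P.
      Witness : Constraint d → Set
      Witness (v , s) = Σ (Point d) λ x → Σ (Point d) λ y →
        InA x × InA y × ¬ P y × v ⊕ y ≡ x × (T s → P x)

      constraintsFor-witnessed : ∀ {h} → InA h → (h∈P? : Dec (P h)) → All Witness (constraintsFor h h∈P?)
      constraintsFor-witnessed {h} h∈A (yes h∈P) =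
        (h , 0ᵛ , h∈A , 0ᵛ∈A , proper , ⊕-identityʳ h , λ _ → h∈P) ∷ []
      constraintsFor-witnessed {h} h∈A (no h∉P) =
        (h , 0ᵛ , h∈A , 0ᵛ∈A , proper , ⊕-identityʳ h , λ ()) ∷
        (0ᵛ , h , 0ᵛ∈A , h∈A , h∉P , ⊕-inverseˡ h , λ ()) ∷ []

      constraints-witnessed : ∀ {m} {hs : Vec (Point d) m} → Allᵛ InA hs → All Witness (constraints hs)
      constraints-witnessed [] = []
      constraints-witnessed (h∈A ∷ hs⊆A) =
        All.++⁺ (constraintsFor-witnessed h∈A em) (constraints-witnessed hs⊆A)

      witness-add : ∀ {u w b c} → Witness (u , b) → Witness (w , c) → Witness (u ⊕ w , b ∨ c)
      witness-add {u} {w} {b} {c} (x₁ , y₁ , x₁∈A , y₁∈A , y₁∉P , e₁ , strict₁)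
                                  (x₂ , y₂ , x₂∈A , y₂∈A , y₂∉P , e₂ , strict₂) =
        x₁ ⊕ x₂ , y₁ ⊕ y₂ , ⊕∈A x₁∈A x₂∈A , ⊕∈A y₁∈A y₂∈A ,
        (λ y∈P → [ y₁∉P , y₂∉P ]′ (prime y₁∈A y₂∈A y∈P)) ,
        trans (⊕-interchange u w y₁ y₂) (cong₂ _⊕_ e₁ e₂) ,
        strict b c strict₁ strict₂
        where
        strict : ∀ b c → (T b → P x₁) → (T c → P x₂) → T (b ∨ c) → P (x₁ ⊕ x₂)
        strict true _ strict₁ _ t = absorbs (strict₁ t) x₂∈A
        strict false _ _ strict₂ t = absorbsˡ x₁∈A (strict₂ t)

      derivable-witnessed : ∀ {c} → constraints gs ⊢ c → Witness c
      derivable-witnessed (assumption c∈) = All.lookup (constraints-witnessed (generators∈semigroup gs)) c∈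
      derivable-witnessed (add D E) = witness-add (derivable-witnessed D) (derivable-witnessed E)

      ⊬0>0 : ¬ constraints gs ⊢ (0ᵛ , true)
      ⊬0>0 D with derivable-witnessed D
      ... | x , y , _ , _ , y∉P , 0+y≡x , x∈P = y∉P (subst P (trans (sym 0+y≡x) (⊕-identityˡ y)) (x∈P tt))

      solution : ∃ λ φ → All (Satisfies φ) (constraints gs)
      solution = motzkin d (constraints gs) ⊬0>0

      φ : Point d
      φ = proj₁ solution

      Separates : Subset d
      Separates a = (P a → +0 Z.< dot φ a) × (¬ P a → dot φ a ≡ +0)

      constraintsFor-separates : ∀ {h} (h∈P? : Dec (P h)) → All (Satisfies φ) (constraintsFor h h∈P?) → Separates h
      constraintsFor-separates (yes h∈P) (0<φh ∷ []) = (λ _ → 0<φh) , (λ h∉P → ⊥-elim (h∉P h∈P))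
      constraintsFor-separates {h} (no h∉P) (0≤φh ∷ 0≤φ-h ∷ []) =
        (λ h∈P → ⊥-elim (h∉P h∈P)) , λ _ → ZP.≤-antisym φh≤0 0≤φh
        where
        φh≤0 : dot φ h Z.≤ +0
        φh≤0 = subst (Z._≤ +0) (ZP.neg-involutive (dot φ h))
          (ZP.neg-mono-≤ (subst (+0 Z.≤_) (dot--ᵛʳ φ h) 0≤φ-h))

      generators-separated : ∀ {m} (hs : Vec (Point d) m) → All (Satisfies φ) (constraints hs) → Allᵛ Separates hs
      generators-separated [] _ = []
      generators-separated (h ∷ hs) sat =
        constraintsFor-separates em (All.++⁻ˡ (constraintsFor h em) sat) ∷
        generators-separated hs (All.++⁻ʳ (constraintsFor h em) sat)

      separates⇒nonneg : ∀ {a} → Separates a → +0 Z.≤ dot φ a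
      separates⇒nonneg {a} (positive , vanishing) with em {P a}
      ... | yes a∈P = ZP.<⇒≤ (positive a∈P)
      ... | no a∉P = ZP.≤-reflexive (sym (vanishing a∉P))

      separates-⊕ : ∀ {a b} → InA a → InA b → Separates a → Separates b → Separates (a ⊕ b)
      separates-⊕ {a} {b} a∈A b∈A sa@(posa , zeroa) sb@(posb , zerob) = positive , vanishing
        where
        positive : P (a ⊕ b) → +0 Z.< dot φ (a ⊕ b)
        positive ab∈P with prime a∈A b∈A ab∈P
        ... | inj₁ a∈P = subst (+0 Z.<_) (sym (dot-⊕ʳ φ a b)) (ZP.+-mono-<-≤ (posa a∈P) (separates⇒nonneg sb))
        ... | inj₂ b∈P = subst (+0 Z.<_) (sym (dot-⊕ʳ φ a b)) (ZP.+-mono-≤-< (separates⇒nonneg sa) (posb b∈P))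
        vanishing : ¬ P (a ⊕ b) → dot φ (a ⊕ b) ≡ +0
        vanishing ab∉P = trans (dot-⊕ʳ φ a b)
          (cong₂ Z._+_ (zeroa λ a∈P → ab∉P (absorbs a∈P b∈A)) (zerob λ b∈P → ab∉P (absorbsˡ a∈A b∈P)))

      separated : ∀ {a} → InA a → Separates a
      separated a∈A = proj₂ (InSemigroup-induction (λ a → InA a × Separates a)
        (0ᵛ∈A , (λ 0∈P → ⊥-elim (proper 0∈P)) , (λ _ → dot-0ᵛʳ φ))
        (λ { (a∈A , sa) (b∈A , sb) → ⊕∈A a∈A b∈A , separates-⊕ a∈A b∈A sa sb })
        (Allᵛ.zip (generators∈semigroup gs , generators-separated gs (proj₂ solution))) a∈A)

    prime-complement-is-face : ∀ {P} → IsPrimeIdeal P →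
      ∃ λ φ → Supporting gs φ × (∀ {a} → InA a → (dot φ a ≡ +0 ⇔ (¬ P a)))
    prime-complement-is-face isPrime =
      φ , Supporting-nonneg (Allᵛ.map (separates⇒nonneg ∘ separated) (generators∈semigroup gs)) ,
      λ a∈A → mk⇔ (λ φa≡0 a∈P → ZP.<-irrefl (sym φa≡0) (proj₁ (separated a∈A) a∈P))
                  (proj₂ (separated a∈A))
      where open PrimeFace isPrime

    module Stratification (M : Subset d) (ideal : IsIdeal gs M) where

      M⊆A : ∀ {x} → M x → InA x
      M⊆A = proj₁ ideal _

      M+A⊆M : ∀ {x a} → M x → InA a → M (x ⊕ a)
      M+A⊆M = proj₂ ideal _ _

      Stratum : Set
      Stratum = Point d × Point d

      InStratum : Stratum → Subset d
      InStratum s = InTranslate gs (proj₁ s) (proj₂ s)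

      Covered : List Stratum → Subset d
      Covered S = InIdeal (List.map proj₁ S)

      -- The colon ideal (⟨S⟩ : y); only its elements in A matter.
      Colon : List Stratum → Point d → Subset d
      Colon S y a = Covered S (y ⊕ a)

      Colon-≼ : ∀ {S y a b} → Colon S y a → a ≼ b → Colon S y b
      Colon-≼ {S} {y} {a} a∈ (e , e∈A , refl) = subst (Covered S) (⊕-assoc y a e) (InIdeal-⊕ʳ a∈ e∈A)

      NotPrime : List Stratum → Point d → Set
      NotPrime S y = Σ (Point d) λ a → Σ (Point d) λ b →
        InA a × InA b × Colon S y (a ⊕ b) × ¬ Colon S y a × ¬ Colon S y b

      Colon-prime : ∀ {S y} → ¬ Covered S y → ¬ NotPrime S y → IsPrimeIdeal (Colon S y)
      Colon-prime {S} {y} y∉ ¬notPrime = record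
        { proper = λ 0∈ → y∉ (subst (Covered S) (⊕-identityʳ y) 0∈)
        ; absorbs = λ a∈ b∈A → Colon-≼ a∈ (_ , b∈A , refl)
        ; prime = prime
        }
        where
        prime : ∀ {a b} → InA a → InA b → Colon S y (a ⊕ b) → Colon S y a ⊎ Colon S y b
        prime {a} {b} a∈A b∈A ab∈ with em {Colon S y a} | em {Colon S y b}
        ... | yes a∈ | _ = inj₁ a∈
        ... | no _ | yes b∈ = inj₂ b∈
        ... | no a∉ | no b∉ = ⊥-elim (¬notPrime (a , b , a∈A , b∈A , ab∈ , a∉ , b∉))

      -- While (⟨S⟩ : y) is not prime, witnessed by a + b, replace y by y + a: then b joins the
      -- colon ideal, so the list bs of such b's generates a strictly increasing chain of ideals.
      prime-colon : ∀ S y → M y → ¬ Covered S y → (bs : List (Point d)) → All (Colon S y) bs →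
        Acc _Enlarges_ bs → Σ (Point d) λ y* → M y* × ¬ Covered S y* × IsPrimeIdeal (Colon S y*)
      prime-colon S y y∈M y∉ bs bs⊆ (acc rs) with em {NotPrime S y}
      ... | no ¬notPrime = y , y∈M , y∉ , Colon-prime y∉ ¬notPrime
      ... | yes (a , b , a∈A , b∈A , ab∈ , a∉ , b∉) =
        prime-colon S (y ⊕ a) (M+A⊆M y∈M a∈A) a∉ (b ∷ bs)
          (subst (Covered S) (sym (⊕-assoc y a b)) ab∈ ∷ All.map shift bs⊆)
          (rs (enlarge b∈A b∉⟨bs⟩))
        where
        shift : ∀ {c} → Colon S y c → Colon S (y ⊕ a) c
        shift {c} c∈ = subst (Covered S) (swap y c a) (InIdeal-⊕ʳ c∈ a∈A)
          where
          swap : ∀ y c a → (y ⊕ c) ⊕ a ≡ (y ⊕ a) ⊕ c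
          swap y c a = trans (⊕-assoc y c a) (trans (cong (y ⊕_) (⊕-comm c a)) (sym (⊕-assoc y a c)))
        b∉⟨bs⟩ : ¬ InIdeal bs b
        b∉⟨bs⟩ b∈⟨bs⟩ with All.lookupAny bs⊆ b∈⟨bs⟩
        ... | c∈ , c≼b = b∉ (Colon-≼ c∈ c≼b)

      record IsPartialStratification (S : List Stratum) : Set where
        field
          supporting : All (Supporting gs ∘ proj₂) S
          translates∈M : All (M ∘ proj₁) S
          covers : ∀ {z} → Covered S z → ∃ λ i → InStratum (lookup S i) z
          disjoint : ∀ {z} i j → InStratum (lookup S i) z → InStratum (lookup S j) z → i ≡ j

      open IsPartialStratification

      IsPartialStratification-[] : IsPartialStratification []
      IsPartialStratification-[] = record { supporting = [] ; translates∈M = [] ; covers = λ () ; disjoint = λ () }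

      stratum⊆covered : ∀ S i {z} → InStratum (lookup S i) z → Covered S z
      stratum⊆covered (s ∷ S) zero (a , (a∈A , _) , z≡) = here (a , a∈A , z≡)
      stratum⊆covered (s ∷ S) (suc i) z∈ = there (stratum⊆covered S i z∈)

      add-stratum : ∀ {S y φ} → IsPartialStratification S → M y → Supporting gs φ →
        (∀ {a} → InA a → (dot φ a ≡ +0 ⇔ (¬ Colon S y a))) → IsPartialStratification ((y , φ) ∷ S)
      add-stratum {S} {y} {φ} partial y∈M φ-supporting face = record
        { supporting = φ-supporting ∷ supporting partial
        ; translates∈M = y∈M ∷ translates∈M partial
        ; covers = covers′
        ; disjoint = disjoint′
        }
        where
        new∩old : ∀ {z} j → InStratum (y , φ) z → ¬ InStratum (lookup S j) z
        new∩old j (a , (a∈A , φa≡0) , refl) z∈old = Equivalence.to (face a∈A) φa≡0 (stratum⊆covered S j z∈old)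
        covers′ : ∀ {z} → Covered ((y , φ) ∷ S) z → ∃ λ i → InStratum (lookup ((y , φ) ∷ S) i) z
        covers′ (here (a , a∈A , refl)) with em {Colon S y a}
        ... | no a∉ = zero , a , (a∈A , Equivalence.from (face a∈A) a∉) , refl
        ... | yes a∈ with covers partial a∈
        ...   | i , z∈ᵢ = suc i , z∈ᵢ
        covers′ (there z∈) with covers partial z∈
        ... | i , z∈ᵢ = suc i , z∈ᵢ
        disjoint′ : ∀ {z} i j → InStratum (lookup ((y , φ) ∷ S) i) z →
          InStratum (lookup ((y , φ) ∷ S) j) z → i ≡ j
        disjoint′ zero zero _ _ = refl
        disjoint′ zero (suc j) z∈new z∈old = ⊥-elim (new∩old j z∈new z∈old)
        disjoint′ (suc i) zero z∈old z∈new = ⊥-elim (new∩old i z∈new z∈old)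
        disjoint′ (suc i) (suc j) z∈ᵢ z∈ⱼ = cong suc (disjoint partial i j z∈ᵢ z∈ⱼ)

      Stratified : Set
      Stratified = ∃ λ (k : ℕ) → Σ (Fin k → Point d) λ f → Σ (Fin k → Point d) λ φ →
        IsStratificationByFaces gs M f φ

      complete : ∀ {S} → IsPartialStratification S → (∀ {z} → M z → Covered S z) → Stratified
      complete {S} partial M⊆covered =
        length S , proj₁ ∘ lookup S , proj₂ ∘ lookup S ,
        (λ i → All.lookup (supporting partial) (∈-lookup i)) ,
        (λ z z∈M → covers partial (M⊆covered z∈M)) ,
        (λ { z i (a , (a∈A , _) , refl) → M+A⊆M (All.lookup (translates∈M partial) (∈-lookup i)) a∈A }) ,
        (λ z → disjoint partial)

      stratify : ∀ S → IsPartialStratification S → Acc _Enlarges_ (List.map proj₁ S) → Stratified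
      stratify S partial (acc rs) with em {Σ (Point d) λ x → M x × ¬ Covered S x}
      ... | no ∄uncovered = complete partial λ {z} z∈M → dne λ z∉ → ∄uncovered (z , z∈M , z∉)
      ... | yes (x , x∈M , x∉) with prime-colon S x x∈M x∉ [] [] (enlarges-wellFounded [])
      ...   | y , y∈M , y∉ , colon-prime with prime-complement-is-face colon-prime
      ...     | φ , φ-supporting , face =
        stratify ((y , φ) ∷ S) (add-stratum partial y∈M φ-supporting face) (rs (enlarge (M⊆A y∈M) y∉))

lemma3p4 : ExcludedMiddle 0ℓ →
    (d n : ℕ) (gs : Vec (Point d) n) (M : Subset d) → IsIdeal gs M →
    ∃ λ (k : ℕ) → Σ (Fin k → Point d) λ f → Σ (Fin k → Point d) λ φ →
      IsStratificationByFaces gs M f φ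
lemma3p4 em d n gs M ideal = stratify [] IsPartialStratification-[] (enlarges-wellFounded em [])
  where
  open AffineSemigroup gs
  open Stratification em M ideal
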